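{- For every formula $A$ of $\mathcal L$, if $A$ is valid in every minimal birelational model, then $A$ is derivable in $\mathsf{MK}$.
   Context: $\mathcal L$ is the language $A ::= p \mid \bot \mid A\wedge A \mid A\vee A \mid A\to A \mid \Box A \mid \Diamond A$ over a countable set $\mathrm{Atm}$ of propositional variables. Minimal propositional logic $\mathsf{MPL}$ is axiomatised by $A\wedge B\to A$, $A\wedge B\to B$, $A\to A\vee B$, $B\to A\vee B$, $(A\to B)\to((A\to C)\to(A\to B\wedge C))$, $(A\to C)\to((B\to C)\to(A\vee B\to C))$, $(A\to(B\to C))\to((A\to B)\to(A\to C))$, $A\to(B\to A)$, and modus ponens. $\mathsf{MK}$ extends $\mathsf{MPL}$ over $\mathcal L$ with the axioms $\Box(A\to B)\to(\Box A\to\Box B)$, $\Box(A\to B)\to(\Diamond A\to\Diamond B)$ and the rule $A/\Box A$. A minimal birelational model is a tuple $\langle W,\le,F,R,V\rangle$ with $W\neq\emptyset$, $\le$ a reflexive transitive relation on $W$, $F\subseteq W$ upward closed under $\le$, $R$ a binary relation on $W$, and $V:\mathrm{Atm}\to\mathcal P(W)$ with each $V(p)$ upward closed under $\le$. Forcing: $w\Vdash p$ iff $w\in V(p)$; $w\Vdash\bot$ iff $w\in F$; $\wedge,\vee$ pointwise; $w\Vdash B\to C$ iff for all $v\ge w$, $v\Vdash B$ implies $v\Vdash C$; $w\Vdash\Box B$ iff for all $v\ge w$ and all $u$ with $vRu$, $u\Vdash B$; $w\Vdash\Diamond B$ iff for all $v\ge w$ there is $u$ with $vRu$ and $u\Vdash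 B$. $A$ is valid in a model if it is forced at every world. -}

module Defs where

open import Level using (Level; _⊔_; suc)
open import Data.Nat using (ℕ)
open import Data.Product using (_×_; Σ-syntax)
open import Data.Sum using (_⊎_)
open import Relation.Unary using (Pred; _∈_)
open import Relation.Binary using (Rel; IsPreorder)
open import Relation.Binary.PropositionalEquality using (_≡_)

Atm : Set
Atm = ℕ

infixr 5 _⇒_
infixl 7 _∧_
infixl 6 _∨_

data Form : Set where
  var : Atm → Form
  ⊥'  : Form
  _∧_ : Form → Form → Form
  _∨_ : Form → Form → Form
  _⇒_ : Form → Form → Form
  □   : Form → Form
  ◇   : Form → Form

data MK⊢ : Form → Set where
  ax∧₁ : ∀ {A B} → MK⊢ (A ∧ B ⇒ A)
  ax∧₂ : ∀ {A B} → MK⊢ (A ∧ B ⇒ B)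
  ax∨₁ : ∀ {A B} → MK⊢ (A ⇒ A ∨ B)
  ax∨₂ : ∀ {A B} → MK⊢ (B ⇒ A ∨ B)
  ax∧I : ∀ {A B C} → MK⊢ ((A ⇒ B) ⇒ ((A ⇒ C) ⇒ (A ⇒ B ∧ C)))
  ax∨E : ∀ {A B C} → MK⊢ ((A ⇒ C) ⇒ ((B ⇒ C) ⇒ (A ∨ B ⇒ C)))
  axS  : ∀ {A B C} → MK⊢ ((A ⇒ (B ⇒ C)) ⇒ ((A ⇒ B) ⇒ (A ⇒ C)))
  axK  : ∀ {A B} → MK⊢ (A ⇒ (B ⇒ A))
  mp   : ∀ {A B} → MK⊢ (A ⇒ B) → MK⊢ A → MK⊢ B
  ax□  : ∀ {A B} → MK⊢ (□ (A ⇒ B) ⇒ (□ A ⇒ □ B))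
  ax◇  : ∀ {A B} → MK⊢ (□ (A ⇒ B) ⇒ (◇ A ⇒ ◇ B))
  nec  : ∀ {A} → MK⊢ A → MK⊢ (□ A)

record Model (ℓ : Level) : Set (suc ℓ) where
  field
    W        : Set ℓ
    inhabited : W
    _≤_      : Rel W ℓ
    ≤-refl   : ∀ {w} → w ≤ w
    ≤-trans  : ∀ {u v w} → u ≤ v → v ≤ w → u ≤ w
    F        : Pred W ℓ
    F-up     : ∀ {w v} → w ≤ v → w ∈ F → v ∈ F
    R        : Rel W ℓ
    V        : Atm → Pred W ℓ
    V-up     : ∀ p {w v} → w ≤ v → w ∈ V p → v ∈ V p

module _ {ℓ : Level} (M : Model ℓ) where
  open Model M

  _⊩_ : W → Form → Set ℓ
  w ⊩ var p = w ∈ V p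
  w ⊩ ⊥' = w ∈ F
  w ⊩ (B ∧ C) = (w ⊩ B) × (w ⊩ C)
  w ⊩ (B ∨ C) = (w ⊩ B) ⊎ (w ⊩ C)
  w ⊩ (B ⇒ C) = ∀ v → w ≤ v → v ⊩ B → v ⊩ C
  w ⊩ □ B = ∀ v → w ≤ v → ∀ u → R v u → u ⊩ B
  w ⊩ ◇ B = ∀ v → w ≤ v → Σ[ u ∈ W ] (R v u × u ⊩ B)

  ValidIn : Form → Set ℓ
  ValidIn A = ∀ w → w ⊩ A

{-# OPTIONS --safe #-}
-- Completeness through a finite canonical model built from the subformulas of A.
-- On sequents Γ ⇒ C whose formulas are subformulas of A, a cut-free sequent
-- calculus with the modal rule  a, {B | □B ∈ Γ} ⇒ b  /  Γ ⇒ ◇b  (◇a ∈ Γ)  is taken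
-- as the least fixed point of its rules. There are finitely many such sequents,
-- so the fixed point is reached after finitely many iterations and derivability
-- is decidable; every rule is admissible in MK with hypotheses, so derivable
-- sequents are MK-derivable. If ∅ ⇒ A is not derivable, it extends to a set Γ
-- that is saturated for the left rules and still does not derive A. Saturated
-- sets, ordered by inclusion and possibly carrying a pending ◇-formula, form a
-- minimal birelational model in which members of a world are forced and formulas
-- it does not derive are not, so A fails at Γ.
module Submission where

open import Defs
open import Level using (Level; 0ℓ)
open import Function using (_∘_; id; const; case_of_)
open import Data.Empty using (⊥; ⊥-elim)
open import Data.Fin using (Fin)
open import Data.List using (List; []; _∷_; _++_; length; lookup; allFin; cartesianProduct)
open import Data.List.Relation.Unary.Enumerates.Setoid using (IsEnumeration)
open import Data.Maybe as Maybe using (Maybe; just; nothing; zipWith)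
open import Data.Maybe.Relation.Unary.All using (All; just; nothing)
open import Data.Nat using (ℕ; zero; suc)
import Data.Nat.Properties as ℕ
open import Data.Product as Product using (_×_; _,_; ∃-syntax; proj₁; proj₂; uncurry)
open import Data.Sum using (_⊎_; inj₁; inj₂; [_,_])
import Data.Sum as Sum
open import Data.Unit using (⊤; tt)
open import Relation.Binary.Definitions using (DecidableEquality)
open import Relation.Binary.PropositionalEquality as ≡
  using (_≡_; refl; cong; cong₂; trans; sym)
open import Relation.Nullary using (Dec; yes; no; does; ¬_; contradiction)
open import Relation.Nullary.Decidable
  using (dec⇒maybe; dec-true; map′; ¬?; _×-dec_; _⊎-dec_; _→-dec_; decidable-stable)
open import Relation.Unary using (Pred; Decidable; _⊆_)

module Hilbert where
  open import Relation.Unary using (_∈_; ∅; ｛_｝; _∪_)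

  infix  3 _⊢_
  infixl 5 _·_

  data _⊢_ (Γ : Pred Form 0ℓ) : Form → Set where
    hyp : ∀ {A} → A ∈ Γ → Γ ⊢ A
    thm : ∀ {A} → MK⊢ A → Γ ⊢ A
    _·_ : ∀ {A B} → Γ ⊢ A ⇒ B → Γ ⊢ A → Γ ⊢ B

  MK⊢-refl : ∀ {A} → MK⊢ (A ⇒ A)
  MK⊢-refl {A} = mp (mp (axS {A} {A ⇒ A} {A}) axK) (axK {A} {A})

  deduction : ∀ {Γ Δ A B} → Δ ⊆ ｛ A ｝ ∪ Γ → Δ ⊢ B → Γ ⊢ A ⇒ B
  deduction Δ⊆ (hyp h) with Δ⊆ h
  ... | inj₁ refl = thm MK⊢-refl
  ... | inj₂ h′ = thm axK · hyp h′
  deduction Δ⊆ (thm t) = thm axK · thm t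
  deduction Δ⊆ (d · e) = thm axS · deduction Δ⊆ d · deduction Δ⊆ e

  ∧-intro : ∀ {Γ A B} → Γ ⊢ A → Γ ⊢ B → Γ ⊢ A ∧ B
  ∧-intro d e = thm ax∧I · thm MK⊢-refl · (thm axK · e) · d

  □-lift : ∀ {Γ Δ B} → (∀ {F} → F ∈ Δ → □ F ∈ Γ) → Δ ⊢ B → Γ ⊢ □ B
  □-lift boxed (hyp h) = hyp (boxed h)
  □-lift boxed (thm t) = thm (nec t)
  □-lift boxed (d · e) = thm ax□ · □-lift boxed d · □-lift boxed e

  ⊢⇒MK⊢ : ∀ {Γ A} → Γ ⊆ ∅ → Γ ⊢ A → MK⊢ A
  ⊢⇒MK⊢ Γ⊆∅ (hyp h) with () ← Γ⊆∅ h
  ⊢⇒MK⊢ Γ⊆∅ (thm t) = t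
  ⊢⇒MK⊢ Γ⊆∅ (d · e) = mp (⊢⇒MK⊢ Γ⊆∅ d) (⊢⇒MK⊢ Γ⊆∅ e)

open Hilbert

-- A matcher that only ever answers positively needs no off-diagonal cases;
-- its reflexivity is then enough to decide equality.
private
  match : (A B : Form) → Maybe (A ≡ B)
  match (var p) (var q) = Maybe.map (cong var) (dec⇒maybe (p ℕ.≟ q))
  match ⊥' ⊥' = just refl
  match (a ∧ b) (c ∧ d) = zipWith (cong₂ _∧_) (match a c) (match b d)
  match (a ∨ b) (c ∨ d) = zipWith (cong₂ _∨_) (match a c) (match b d)
  match (a ⇒ b) (c ⇒ d) = zipWith (cong₂ _⇒_) (match a c) (match b d)
  match (□ a) (□ c) = Maybe.map (cong □) (match a c)
  match (◇ a) (◇ c) = Maybe.map (cong ◇) (match a c)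
  match _ _ = nothing

  match-refl : ∀ A → match A A ≡ just refl
  match-refl (var p) rewrite ℕ.≟-diag (refl {x = p}) = refl
  match-refl ⊥' = refl
  match-refl (a ∧ b) rewrite match-refl a | match-refl b = refl
  match-refl (a ∨ b) rewrite match-refl a | match-refl b = refl
  match-refl (a ⇒ b) rewrite match-refl a | match-refl b = refl
  match-refl (□ a) rewrite match-refl a = refl
  match-refl (◇ a) rewrite match-refl a = refl

_≟_ : DecidableEquality Form
A ≟ B with match A B in eq
... | just A≡B = yes A≡B
... | nothing = no λ { refl → case trans (sym eq) (match-refl A) of λ () }

module Subformulas where
  open import Data.List.Membership.Propositional using (_∈_)
  open import Data.List.Membership.Propositional.Properties using (∈-++⁺ˡ; ∈-++⁺ʳ; ∈-++⁻)
  open import Data.List.Relation.Unary.Any using (here; there)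

  subformulas properSubformulas : Form → List Form
  subformulas A = A ∷ properSubformulas A

  properSubformulas (var _) = []
  properSubformulas ⊥' = []
  properSubformulas (a ∧ b) = subformulas a ++ subformulas b
  properSubformulas (a ∨ b) = subformulas a ++ subformulas b
  properSubformulas (a ⇒ b) = subformulas a ++ subformulas b
  properSubformulas (□ a) = subformulas a
  properSubformulas (◇ a) = subformulas a

  infix 4 _≼_

  _≼_ : Form → Form → Set
  B ≼ A = B ∈ subformulas A

  ≼-refl : ∀ {A} → A ≼ A
  ≼-refl = here refl

  ≼-trans : ∀ {A B C} → C ≼ B → B ≼ A → C ≼ A
  ≼-trans-++ : ∀ a b {B C} → C ≼ B → B ∈ subformulas a ++ subformulas b →
               C ∈ subformulas a ++ subformulas b

  ≼-trans C≼B (here refl) = C≼B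
  ≼-trans {a ∧ b} C≼B (there B≺A) = there (≼-trans-++ a b C≼B B≺A)
  ≼-trans {a ∨ b} C≼B (there B≺A) = there (≼-trans-++ a b C≼B B≺A)
  ≼-trans {a ⇒ b} C≼B (there B≺A) = there (≼-trans-++ a b C≼B B≺A)
  ≼-trans {□ a} C≼B (there B≼a) = there (≼-trans C≼B B≼a)
  ≼-trans {◇ a} C≼B (there B≼a) = there (≼-trans C≼B B≼a)

  ≼-trans-++ a b C≼B B∈ with ∈-++⁻ (subformulas a) B∈
  ... | inj₁ B≼a = ∈-++⁺ˡ (≼-trans C≼B B≼a)
  ... | inj₂ B≼b = ∈-++⁺ʳ (subformulas a) (≼-trans C≼B B≼b)

  ∧≼⇒ˡ : ∀ {a b A} → a ∧ b ≼ A → a ≼ A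
  ∧≼⇒ˡ = ≼-trans (there (∈-++⁺ˡ ≼-refl))
  ∧≼⇒ʳ : ∀ {a b A} → a ∧ b ≼ A → b ≼ A
  ∧≼⇒ʳ {a} = ≼-trans (there (∈-++⁺ʳ (subformulas a) ≼-refl))
  ∨≼⇒ˡ : ∀ {a b A} → a ∨ b ≼ A → a ≼ A
  ∨≼⇒ˡ = ≼-trans (there (∈-++⁺ˡ ≼-refl))
  ∨≼⇒ʳ : ∀ {a b A} → a ∨ b ≼ A → b ≼ A
  ∨≼⇒ʳ {a} = ≼-trans (there (∈-++⁺ʳ (subformulas a) ≼-refl))
  ⇒≼⇒ˡ : ∀ {a b A} → a ⇒ b ≼ A → a ≼ A
  ⇒≼⇒ˡ = ≼-trans (there (∈-++⁺ˡ ≼-refl))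
  ⇒≼⇒ʳ : ∀ {a b A} → a ⇒ b ≼ A → b ≼ A
  ⇒≼⇒ʳ {a} = ≼-trans (there (∈-++⁺ʳ (subformulas a) ≼-refl))
  □≼⇒ : ∀ {a A} → □ a ≼ A → a ≼ A
  □≼⇒ = ≼-trans (there ≼-refl)
  ◇≼⇒ : ∀ {a A} → ◇ a ≼ A → a ≼ A
  ◇≼⇒ = ≼-trans (there ≼-refl)

open Subformulas

module Comprehension {n : ℕ} where
  open import Data.Fin.Subset using (Subset; _∈_)
  open import Data.Vec using (tabulate)
  open import Data.Vec.Properties using (lookup∘tabulate; []=⇒lookup; lookup⇒[]=)

  ⟪_⟫ : {P : Pred (Fin n) 0ℓ} → Decidable P → Subset n
  ⟪ P? ⟫ = tabulate (does ∘ P?)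

  module _ {P : Pred (Fin n) 0ℓ} (P? : Decidable P) {i : Fin n} where

    ∈⟪⟫⁺ : P i → i ∈ ⟪ P? ⟫
    ∈⟪⟫⁺ p = lookup⇒[]= i _ (trans (lookup∘tabulate _ i) (dec-true (P? i) p))

    ∈⟪⟫⁻ : i ∈ ⟪ P? ⟫ → P i
    ∈⟪⟫⁻ i∈ with P? i | trans (sym (lookup∘tabulate (does ∘ P?) i)) ([]=⇒lookup i∈)
    ... | yes p | _ = p
    ... | no _ | ()

open Comprehension

module Enumeration where
  open import Data.Fin.Subset using (Subset; inside; outside)
  open import Data.List.Membership.Propositional using (_∈_)
  open import Data.List using (cartesianProductWith)
  open import Data.List.Membership.Propositional.Properties
    using (∈-cartesianProductWith⁺)
  open import Data.List.Relation.Unary.Any using (here; there)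
  open import Data.Vec using ([]; _∷_)

  subsets : ∀ n → List (Subset n)
  subsets zero = [] ∷ []
  subsets (suc n) = cartesianProductWith _∷_ (inside ∷ outside ∷ []) (subsets n)

  subsets-enumerates : ∀ n → IsEnumeration (≡.setoid (Subset n)) (subsets n)
  subsets-enumerates zero [] = here refl
  subsets-enumerates (suc n) (s ∷ p) =
    ∈-cartesianProductWith⁺ _∷_ (side s) (subsets-enumerates n p)
    where
      side : ∀ s → s ∈ inside ∷ outside ∷ []
      side inside = here refl
      side outside = there (here refl)

open Enumeration

module LeastFixedPoint
  {I : Set} (enum : List I) (enumerates : IsEnumeration (≡.setoid I) enum)
  (Φ : Pred I 0ℓ → Pred I 0ℓ)
  (Φ-mono : ∀ {P Q} → P ⊆ Q → Φ P ⊆ Φ Q)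
  (Φ-dec : ∀ {P} → Decidable P → Decidable (Φ P))
  where
  open import Data.Fin.Subset using (_⊂_; _⊃_)
  open import Data.Fin.Subset.Properties using (_⊂?_)
  open import Data.Fin.Subset.Induction using (Acc; acc; ⊃-wellFounded)
  open import Data.List.Relation.Unary.Any using (index)
  open import Data.List.Relation.Unary.Any.Properties using (lookup-index)

  iterate : ℕ → Pred I 0ℓ
  iterate zero = λ _ → ⊥
  iterate (suc k) = Φ (iterate k)

  iterate-dec : ∀ k → Decidable (iterate k)
  iterate-dec zero _ = no λ ()
  iterate-dec (suc k) = Φ-dec (iterate-dec k)

  iterate-⊆-suc : ∀ k → iterate k ⊆ iterate (suc k)
  iterate-⊆-suc zero ()
  iterate-⊆-suc (suc k) = Φ-mono (iterate-⊆-suc k)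

  enum-dec : ∀ k → Decidable (iterate k ∘ lookup enum)
  enum-dec k = iterate-dec k ∘ lookup enum

  Stable : ℕ → Set
  Stable k = iterate (suc k) ⊆ iterate k

  -- Approximants are compared as subsets of positions in the enumeration,
  -- where ⊂ is well founded.
  ⊄⇒stable : ∀ k → ¬ (⟪ enum-dec k ⟫ ⊂ ⟪ enum-dec (suc k) ⟫) → Stable k
  ⊄⇒stable k k⊄k+1 {x} x∈ with iterate-dec k x
  ... | yes x∈k = x∈k
  ... | no x∉k = contradiction k⊂k+1 k⊄k+1
    where
      i = index (enumerates x)
      x≡ : x ≡ lookup enum i
      x≡ = lookup-index (enumerates x)
      k⊂k+1 : ⟪ enum-dec k ⟫ ⊂ ⟪ enum-dec (suc k) ⟫
      k⊂k+1 = (λ i∈ → ∈⟪⟫⁺ (enum-dec (suc k)) (iterate-⊆-suc k (∈⟪⟫⁻ (enum-dec k) i∈)))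
        , i , ∈⟪⟫⁺ (enum-dec (suc k)) (≡.subst (iterate (suc k)) x≡ x∈)
        , λ i∈ → x∉k (≡.subst (iterate k) (sym x≡) (∈⟪⟫⁻ (enum-dec k) i∈))

  stabilise : ∀ k → Acc _⊃_ ⟪ enum-dec k ⟫ → ∃[ j ] Stable j
  stabilise k (acc rec) with ⟪ enum-dec k ⟫ ⊂? ⟪ enum-dec (suc k) ⟫
  ... | yes k⊂k+1 = stabilise (suc k) (rec k⊂k+1)
  ... | no k⊄k+1 = k , ⊄⇒stable k k⊄k+1

  -- Opaque, so that type checking never runs the fixed-point computation.
  opaque
    stable-stage : ∃[ j ] Stable j
    stable-stage = stabilise 0 (⊃-wellFounded _)

  μ : Pred I 0ℓ
  μ = iterate (proj₁ stable-stage)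

  μ-dec : Decidable μ
  μ-dec = iterate-dec (proj₁ stable-stage)

  μ-closed : Φ μ ⊆ μ
  μ-closed = proj₂ stable-stage

  μ-least : ∀ {P} → Φ P ⊆ P → μ ⊆ P
  μ-least {P} ΦP⊆P = below (proj₁ stable-stage)
    where
      below : ∀ k → iterate k ⊆ P
      below zero ()
      below (suc k) = ΦP⊆P ∘ Φ-mono (below k)

module Canonical (A₀ : Form) where
  open import Data.Fin.Subset as Subset using (Subset; _∈_; _⊃_; _∪_)
  open import Data.Fin.Subset.Properties using (_∈?_; x∈p∪q⁺; x∈p∪q⁻; ∈⊤; ∉⊥)
  open import Data.Fin.Subset.Induction using (Acc; acc; ⊃-wellFounded)
  open import Data.Fin.Properties using (any?; all?; ¬∀⟶∃¬)
  open import Data.List.Membership.Propositional.Properties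
    using (∈-lookup; ∈-allFin; ∈-cartesianProduct⁺)
  open import Data.List.Relation.Unary.Any using (index)
  open import Data.List.Relation.Unary.Any.Properties using (lookup-index)

  -- Sets of formulas are subsets of the positions in the list of subformulas of A₀.
  n : ℕ
  n = length (subformulas A₀)

  S : Fin n → Form
  S = lookup (subformulas A₀)

  index-of : ∀ {F} → F ≼ A₀ → ∃[ i ] S i ≡ F
  index-of F≼ = index F≼ , sym (lookup-index F≼)

  Some : Subset n → Pred Form 0ℓ → Set
  Some Γ P = ∃[ i ] (i ∈ Γ × P (S i))

  some? : ∀ Γ {P} → Decidable P → Dec (Some Γ P)
  some? Γ P? = any? λ i → (i ∈? Γ) ×-dec P? (S i)

  infix 4 _∈ᶠ_ _∈ᶠ?_

  _∈ᶠ_ : Form → Subset n → Set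
  F ∈ᶠ Γ = Some Γ (_≡ F)

  _∈ᶠ?_ : ∀ F Γ → Dec (F ∈ᶠ Γ)
  F ∈ᶠ? Γ = some? Γ (_≟ F)

  ⟦_⟧ : Subset n → Pred Form 0ℓ
  ⟦ Γ ⟧ F = F ∈ᶠ Γ

  some-intro : ∀ {Γ P G} → G ∈ᶠ Γ → P G → Some Γ P
  some-intro (i , i∈ , refl) p = i , i∈ , p

  ∈ᶠ⇒≼ : ∀ {F Γ} → F ∈ᶠ Γ → F ≼ A₀
  ∈ᶠ⇒≼ (i , _ , refl) = ∈-lookup i

  ∈ᶠ-⊤ : ∀ {F} → F ≼ A₀ → F ∈ᶠ Subset.⊤
  ∈ᶠ-⊤ F≼ with i , refl ← index-of F≼ = i , ∈⊤ , refl

  ∉ᶠ-⊥ : ⟦ Subset.⊥ ⟧ ⊆ λ _ → ⊥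
  ∉ᶠ-⊥ (_ , i∈⊥ , _) = ∉⊥ i∈⊥

  infixr 5 _◂_

  occurs? : ∀ F → Decidable (λ i → S i ≡ F)
  occurs? F i = S i ≟ F

  _◂_ : Form → Subset n → Subset n
  F ◂ Γ = ⟪ occurs? F ⟫ ∪ Γ

  ◂-here : ∀ {F Γ} → F ≼ A₀ → F ∈ᶠ F ◂ Γ
  ◂-here F≼ with i , refl ← index-of F≼ = i , x∈p∪q⁺ (inj₁ (∈⟪⟫⁺ (occurs? _) refl)) , refl

  ◂-there : ∀ {F Γ} → ⟦ Γ ⟧ ⊆ ⟦ F ◂ Γ ⟧
  ◂-there (i , i∈ , eq) = i , x∈p∪q⁺ (inj₂ i∈) , eq

  ◂⁻ : ∀ {F Γ G} → G ∈ᶠ F ◂ Γ → F ≡ G ⊎ G ∈ᶠ Γ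
  ◂⁻ {Γ = Γ} (i , i∈ , refl) with x∈p∪q⁻ _ Γ i∈
  ... | inj₁ i∈F = inj₁ (sym (∈⟪⟫⁻ (occurs? _) i∈F))
  ... | inj₂ i∈Γ = inj₂ (i , i∈Γ , refl)

  ◂-⊃ : ∀ {F Γ} → F ≼ A₀ → ¬ F ∈ᶠ Γ → (F ◂ Γ) ⊃ Γ
  ◂-⊃ F≼ F∉ with i , refl ← index-of F≼ =
    (λ i∈ → x∈p∪q⁺ (inj₂ i∈))
    , i , x∈p∪q⁺ (inj₁ (∈⟪⟫⁺ (occurs? _) refl)) , λ i∈ → F∉ (i , i∈ , refl)

  boxed? : ∀ Γ → Decidable (λ i → □ (S i) ∈ᶠ Γ)
  boxed? Γ i = □ (S i) ∈ᶠ? Γ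

  unbox : Subset n → Subset n
  unbox Γ = ⟪ boxed? Γ ⟫

  unbox⁺ : ∀ {G Γ} → □ G ∈ᶠ Γ → G ∈ᶠ unbox Γ
  unbox⁺ □G∈ with i , refl ← index-of (□≼⇒ (∈ᶠ⇒≼ □G∈)) = i , ∈⟪⟫⁺ (boxed? _) □G∈ , refl

  unbox⁻ : ∀ {G Γ} → G ∈ᶠ unbox Γ → □ G ∈ᶠ Γ
  unbox⁻ (i , i∈ , refl) = ∈⟪⟫⁻ (boxed? _) i∈

  Judgement : Set₁
  Judgement = Subset n → Form → Set

  Sound : Judgement → Set
  Sound Q = ∀ {Γ F} → Q Γ F → ⟦ Γ ⟧ ⊢ F

  DecidableJ : Judgement → Set
  DecidableJ Q = ∀ Γ F → Dec (Q Γ F)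

  _⊑_ : Judgement → Judgement → Set
  Q ⊑ Q′ = ∀ {Γ F} → Q Γ F → Q′ Γ F

  data Right (Q : Judgement) (Γ : Subset n) : Form → Set where
    ∧R : ∀ {a b} → Q Γ a → Q Γ b → Right Q Γ (a ∧ b)
    ∨R₁ : ∀ {a b} → Q Γ a → Right Q Γ (a ∨ b)
    ∨R₂ : ∀ {a b} → Q Γ b → Right Q Γ (a ∨ b)
    ⇒R : ∀ {a b} → Q (a ◂ Γ) b → Right Q Γ (a ⇒ b)
    □R : ∀ {b} → Q (unbox Γ) b → Right Q Γ (□ b)

  -- Left Q Γ G C: premises of a rule for Γ ⇒ C with principal hypothesis G.
  data Left (Q : Judgement) (Γ : Subset n) : Form → Form → Set where
    ∧L₁ : ∀ {a b C} → Q (a ◂ Γ) C → Left Q Γ (a ∧ b) C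
    ∧L₂ : ∀ {a b C} → Q (b ◂ Γ) C → Left Q Γ (a ∧ b) C
    ∨L : ∀ {a b C} → Q (a ◂ Γ) C → Q (b ◂ Γ) C → Left Q Γ (a ∨ b) C
    ⇒L : ∀ {a b C} → Q Γ a → Q (b ◂ Γ) C → Left Q Γ (a ⇒ b) C
    ◇L : ∀ {a b} → Q (a ◂ unbox Γ) b → Left Q Γ (◇ a) (◇ b)

  -- There is no rule for ⊥: minimal logic treats it as an atom.
  Step : Judgement → Judgement
  Step Q Γ C = C ∈ᶠ Γ ⊎ Right Q Γ C ⊎ Some Γ (λ G → Left Q Γ G C)

  Step-mono : ∀ {Q Q′} → Q ⊑ Q′ → Step Q ⊑ Step Q′
  Step-mono {Q} {Q′} Q⊑Q′ = Sum.map₂ (Sum.map right (Product.map₂ (Product.map₂ left)))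
    where
      right : ∀ {Γ C} → Right Q Γ C → Right Q′ Γ C
      right (∧R x y) = ∧R (Q⊑Q′ x) (Q⊑Q′ y)
      right (∨R₁ x) = ∨R₁ (Q⊑Q′ x)
      right (∨R₂ y) = ∨R₂ (Q⊑Q′ y)
      right (⇒R x) = ⇒R (Q⊑Q′ x)
      right (□R x) = □R (Q⊑Q′ x)
      left : ∀ {Γ G C} → Left Q Γ G C → Left Q′ Γ G C
      left (∧L₁ x) = ∧L₁ (Q⊑Q′ x)
      left (∧L₂ y) = ∧L₂ (Q⊑Q′ y)
      left (∨L x y) = ∨L (Q⊑Q′ x) (Q⊑Q′ y)
      left (⇒L x y) = ⇒L (Q⊑Q′ x) (Q⊑Q′ y)
      left (◇L x) = ◇L (Q⊑Q′ x)

  Step-sound : ∀ {Q} → Sound Q → Sound (Step Q)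
  Step-sound ⊢Q (inj₁ C∈) = hyp C∈
  Step-sound ⊢Q (inj₂ (inj₁ r)) = right r
    where
      right : ∀ {Γ C} → Right _ Γ C → ⟦ Γ ⟧ ⊢ C
      right (∧R x y) = ∧-intro (⊢Q x) (⊢Q y)
      right (∨R₁ x) = thm ax∨₁ · ⊢Q x
      right (∨R₂ y) = thm ax∨₂ · ⊢Q y
      right (⇒R x) = deduction ◂⁻ (⊢Q x)
      right (□R x) = □-lift unbox⁻ (⊢Q x)
  Step-sound ⊢Q (inj₂ (inj₂ (i , i∈ , l))) = left (i , i∈ , refl) l
    where
      left : ∀ {Γ G C} → G ∈ᶠ Γ → Left _ Γ G C → ⟦ Γ ⟧ ⊢ C
      left G∈ (∧L₁ x) = deduction ◂⁻ (⊢Q x) · (thm ax∧₁ · hyp G∈)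
      left G∈ (∧L₂ y) = deduction ◂⁻ (⊢Q y) · (thm ax∧₂ · hyp G∈)
      left G∈ (∨L x y) = thm ax∨E · deduction ◂⁻ (⊢Q x) · deduction ◂⁻ (⊢Q y) · hyp G∈
      left G∈ (⇒L x y) = deduction ◂⁻ (⊢Q y) · (hyp G∈ · ⊢Q x)
      left G∈ (◇L x) = thm ax◇ · □-lift unbox⁻ (deduction ◂⁻ (⊢Q x)) · hyp G∈

  Step-dec : ∀ {Q} → DecidableJ Q → DecidableJ (Step Q)
  Step-dec {Q} Q? Γ C = (C ∈ᶠ? Γ) ⊎-dec right C ⊎-dec some? Γ (λ G → left G C)
    where
      right : ∀ C → Dec (Right Q Γ C)
      right (a ∧ b) = map′ (uncurry ∧R) (λ { (∧R x y) → x , y }) (Q? Γ a ×-dec Q? Γ b)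
      right (a ∨ b) = map′ [ ∨R₁ , ∨R₂ ] (λ { (∨R₁ x) → inj₁ x ; (∨R₂ y) → inj₂ y })
                           (Q? Γ a ⊎-dec Q? Γ b)
      right (a ⇒ b) = map′ ⇒R (λ { (⇒R x) → x }) (Q? (a ◂ Γ) b)
      right (□ b) = map′ □R (λ { (□R x) → x }) (Q? (unbox Γ) b)
      right (var _) = no λ ()
      right ⊥' = no λ ()
      right (◇ _) = no λ ()
      left : ∀ G C → Dec (Left Q Γ G C)
      left (a ∧ b) C = map′ [ ∧L₁ , ∧L₂ ] (λ { (∧L₁ x) → inj₁ x ; (∧L₂ y) → inj₂ y })
                            (Q? (a ◂ Γ) C ⊎-dec Q? (b ◂ Γ) C)
      left (a ∨ b) C = map′ (uncurry ∨L) (λ { (∨L x y) → x , y }) (Q? (a ◂ Γ) C ×-dec Q? (b ◂ Γ) C)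
      left (a ⇒ b) C = map′ (uncurry ⇒L) (λ { (⇒L x y) → x , y }) (Q? Γ a ×-dec Q? (b ◂ Γ) C)
      left (◇ a) (◇ b) = map′ ◇L (λ { (◇L x) → x }) (Q? (a ◂ unbox Γ) b)
      left (◇ _) (var _) = no λ ()
      left (◇ _) ⊥' = no λ ()
      left (◇ _) (_ ∧ _) = no λ ()
      left (◇ _) (_ ∨ _) = no λ ()
      left (◇ _) (_ ⇒ _) = no λ ()
      left (◇ _) (□ _) = no λ ()
      left (var _) _ = no λ ()
      left ⊥' _ = no λ ()
      left (□ _) _ = no λ ()

  -- A sequent Γ ⇒ F is indexed by Γ and a position of F, so there are finitely many.
  lift : Pred (Subset n × Fin n) 0ℓ → Judgement
  lift P Γ F = ∃[ j ] (S j ≡ F × P (Γ , j))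

  Φ : Pred (Subset n × Fin n) 0ℓ → Pred (Subset n × Fin n) 0ℓ
  Φ P (Γ , c) = Step (lift P) Γ (S c)

  lift-dec : ∀ {P} → Decidable P → DecidableJ (lift P)
  lift-dec P? Γ F = any? λ j → (S j ≟ F) ×-dec P? (Γ , j)

  open LeastFixedPoint
    (cartesianProduct (subsets n) (allFin n))
    (λ (Γ , c) → ∈-cartesianProduct⁺ (subsets-enumerates n Γ) (∈-allFin c))
    Φ
    (λ P⊆Q → Step-mono (Product.map₂ (Product.map₂ P⊆Q)))
    (λ P? (Γ , c) → Step-dec (lift-dec P?) Γ (S c))

  infix 4 _⊢ₛ_

  -- Opaque: only the four facts below are used, and unfolding μ makes type
  -- checking very slow.
  opaque
    _⊢ₛ_ : Judgement
    _⊢ₛ_ = lift μ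

    ⊢ₛ-dec : DecidableJ _⊢ₛ_
    ⊢ₛ-dec = lift-dec μ-dec

    ⊢ₛ-sound : Sound _⊢ₛ_
    ⊢ₛ-sound (j , refl , μj) = μ-least (Step-sound λ { (_ , refl , ⊢F) → ⊢F }) μj

    ⊢ₛ-closed : ∀ {Γ F} → F ≼ A₀ → Step _⊢ₛ_ Γ F → Γ ⊢ₛ F
    ⊢ₛ-closed F≼ step with j , refl ← index-of F≼ = j , refl , μ-closed step

  ⊬-left : ∀ {Γ C G} → C ≼ A₀ → ¬ Γ ⊢ₛ C → G ∈ᶠ Γ → ¬ Left _⊢ₛ_ Γ G C
  ⊬-left C≼ ⊬C G∈ l = ⊬C (⊢ₛ-closed C≼ (inj₂ (inj₂ (some-intro G∈ l))))

  ⊬-right : ∀ {Γ C} → C ≼ A₀ → ¬ Γ ⊢ₛ C → ¬ Right _⊢ₛ_ Γ C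
  ⊬-right C≼ ⊬C r = ⊬C (⊢ₛ-closed C≼ (inj₂ (inj₁ r)))

  ⊬-init : ∀ {Γ C} → C ≼ A₀ → ¬ Γ ⊢ₛ C → ¬ C ∈ᶠ Γ
  ⊬-init C≼ ⊬C C∈ = ⊬C (⊢ₛ-closed C≼ (inj₁ C∈))

  Closed : Subset n → Form → Set
  Closed Γ (a ∧ b) = a ∈ᶠ Γ × b ∈ᶠ Γ
  Closed Γ (a ∨ b) = a ∈ᶠ Γ ⊎ b ∈ᶠ Γ
  Closed Γ (a ⇒ b) = b ∈ᶠ Γ ⊎ ¬ Γ ⊢ₛ a
  Closed Γ _ = ⊤

  closed? : ∀ Γ G → Dec (Closed Γ G)
  closed? Γ (a ∧ b) = a ∈ᶠ? Γ ×-dec b ∈ᶠ? Γ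
  closed? Γ (a ∨ b) = a ∈ᶠ? Γ ⊎-dec b ∈ᶠ? Γ
  closed? Γ (a ⇒ b) = b ∈ᶠ? Γ ⊎-dec ¬? (⊢ₛ-dec Γ a)
  closed? Γ (var _) = yes tt
  closed? Γ ⊥' = yes tt
  closed? Γ (□ _) = yes tt
  closed? Γ (◇ _) = yes tt

  Saturated : Subset n → Set
  Saturated Γ = ∀ i → i ∈ Γ → Closed Γ (S i)

  closed-at? : ∀ Γ → Decidable (λ i → i ∈ Γ → Closed Γ (S i))
  closed-at? Γ i = (i ∈? Γ) →-dec closed? Γ (S i)

  saturated? : ∀ Γ → Dec (Saturated Γ)
  saturated? Γ = all? (closed-at? Γ)

  saturated⇒closed : ∀ {Γ G} → Saturated Γ → G ∈ᶠ Γ → Closed Γ G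
  saturated⇒closed sat (i , i∈ , refl) = sat i i∈

  ⊤-saturated : Saturated Subset.⊤
  ⊤-saturated i _ = closed (∈-lookup i)
    where
      closed : ∀ {G} → G ≼ A₀ → Closed Subset.⊤ G
      closed {a ∧ b} G≼ = ∈ᶠ-⊤ (∧≼⇒ˡ G≼) , ∈ᶠ-⊤ (∧≼⇒ʳ G≼)
      closed {a ∨ b} G≼ = inj₁ (∈ᶠ-⊤ (∨≼⇒ˡ G≼))
      closed {a ⇒ b} G≼ = inj₁ (∈ᶠ-⊤ (⇒≼⇒ʳ G≼))
      closed {var _} _ = tt
      closed {⊥'} _ = tt
      closed {□ _} _ = tt
      closed {◇ _} _ = tt

  Extension : Subset n → Form → Set
  Extension Γ C = ∃[ Δ ] (⟦ Γ ⟧ ⊆ ⟦ Δ ⟧ × Saturated Δ × ¬ Δ ⊢ₛ C)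

  -- Repairing one unsaturated formula G ∈ Γ by adding a missing subformula:
  -- if neither candidate extension kept C underivable, a left rule would derive C.
  repair : ∀ {Γ C G} → C ≼ A₀ → ¬ Γ ⊢ₛ C →
           (∀ {F} → F ≼ A₀ → ¬ F ∈ᶠ Γ → ¬ F ◂ Γ ⊢ₛ C → Extension Γ C) →
           G ∈ᶠ Γ → ¬ Closed Γ G → Extension Γ C
  repair {Γ} {C} {a ∧ b} C≼ ⊬C extend G∈ ¬closed with a ∈ᶠ? Γ
  ... | no a∉ = extend (∧≼⇒ˡ (∈ᶠ⇒≼ G∈)) a∉ (⊬-left C≼ ⊬C G∈ ∘ ∧L₁)
  ... | yes a∈ = extend (∧≼⇒ʳ (∈ᶠ⇒≼ G∈)) (¬closed ∘ (a∈ ,_)) (⊬-left C≼ ⊬C G∈ ∘ ∧L₂)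
  repair {Γ} {C} {a ∨ b} C≼ ⊬C extend G∈ ¬closed with ⊢ₛ-dec (a ◂ Γ) C
  ... | no ⊬a = extend (∨≼⇒ˡ (∈ᶠ⇒≼ G∈)) (¬closed ∘ inj₁) ⊬a
  ... | yes ⊢a = extend (∨≼⇒ʳ (∈ᶠ⇒≼ G∈)) (¬closed ∘ inj₂) (⊬-left C≼ ⊬C G∈ ∘ ∨L ⊢a)
  repair {Γ} {C} {a ⇒ b} C≼ ⊬C extend G∈ ¬closed =
    extend (⇒≼⇒ʳ (∈ᶠ⇒≼ G∈)) (¬closed ∘ inj₁) (⊬-left C≼ ⊬C G∈ ∘ ⇒L ⊢a)
    where
      ⊢a : Γ ⊢ₛ a
      ⊢a = decidable-stable (⊢ₛ-dec Γ a) (¬closed ∘ inj₂)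
  repair {G = var _} _ _ _ _ ¬closed = ⊥-elim (¬closed tt)
  repair {G = ⊥'} _ _ _ _ ¬closed = ⊥-elim (¬closed tt)
  repair {G = □ _} _ _ _ _ ¬closed = ⊥-elim (¬closed tt)
  repair {G = ◇ _} _ _ _ _ ¬closed = ⊥-elim (¬closed tt)

  saturate : ∀ {Γ C} → C ≼ A₀ → ¬ Γ ⊢ₛ C → Extension Γ C
  saturate {C = C} C≼ = go _ (⊃-wellFounded _)
    where
      go : ∀ Γ → Acc _⊃_ Γ → ¬ Γ ⊢ₛ C → Extension Γ C
      go Γ (acc rec) ⊬C with saturated? Γ
      ... | yes sat = Γ , id , sat , ⊬C
      ... | no unsat with i , ¬closed-at ← ¬∀⟶∃¬ n _ (closed-at? Γ) unsat =
        repair C≼ ⊬C extend (i , i∈ , refl) (¬closed-at ∘ const)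
        where
          i∈ : i ∈ Γ
          i∈ = decidable-stable (i ∈? Γ) (λ i∉ → ¬closed-at (⊥-elim ∘ i∉))
          extend : ∀ {F} → F ≼ A₀ → ¬ F ∈ᶠ Γ → ¬ F ◂ Γ ⊢ₛ C → Extension Γ C
          extend F≼ F∉ ⊬C′ with Δ , ⊆Δ , satΔ , ⊬CΔ ← go _ (rec (◂-⊃ F≼ F∉)) ⊬C′ =
            Δ , ⊆Δ ∘ ◂-there , satΔ , ⊬CΔ

  -- A world may carry a pending formula ◇ E that it does not derive; its
  -- R-successors are then exactly the saturated sets that do not derive E.
  record World : Set where
    constructor world
    field
      ctx : Subset n
      saturated : Saturated ctx
      pending : Maybe Form
      pending-underivable : All (λ E → ◇ E ≼ A₀ × ¬ ctx ⊢ₛ ◇ E) pending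

  open World

  plain : ∀ Γ → Saturated Γ → World
  plain Γ sat = world Γ sat nothing nothing

  Successor : World → World → Set
  Successor w u = (∀ {G} → □ G ∈ᶠ ctx w → G ∈ᶠ ctx u) × All (λ E → ¬ ctx u ⊢ₛ E) (pending w)

  canonical : Model 0ℓ
  canonical = record
    { W = World
    ; inhabited = plain Subset.⊤ ⊤-saturated
    ; _≤_ = λ w v → ⟦ ctx w ⟧ ⊆ ⟦ ctx v ⟧
    ; ≤-refl = id
    ; ≤-trans = λ u≤v v≤w → v≤w ∘ u≤v
    ; F = λ w → ⊥' ∈ᶠ ctx w
    ; F-up = λ w≤v → w≤v
    ; R = Successor
    ; V = λ p w → var p ∈ᶠ ctx w
    ; V-up = λ _ w≤v → w≤v
    }

  _⊩ᶜ_ : World → Form → Set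
  w ⊩ᶜ F = _⊩_ canonical w F

  ◇-successor : ∀ v {b} → ◇ b ∈ᶠ ctx v → ∃[ u ] (Successor v u × b ∈ᶠ ctx u)
  ◇-successor (world Γ _ nothing nothing) ◇b∈ =
    plain Subset.⊤ ⊤-saturated
    , ((λ □G∈ → ∈ᶠ-⊤ (□≼⇒ (∈ᶠ⇒≼ □G∈))) , nothing)
    , ∈ᶠ-⊤ (◇≼⇒ (∈ᶠ⇒≼ ◇b∈))
  ◇-successor (world Γ _ (just E) (just (◇E≼ , ⊬◇E))) ◇b∈
    with Z , ⊆Z , satZ , ⊬E ← saturate (◇≼⇒ ◇E≼) (⊬-left ◇E≼ ⊬◇E ◇b∈ ∘ ◇L) =
    plain Z satZ , ((⊆Z ∘ ◂-there ∘ unbox⁺) , just ⊬E) , ⊆Z (◂-here (◇≼⇒ (∈ᶠ⇒≼ ◇b∈)))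

  ∈⇒⊩ : ∀ {G} → G ≼ A₀ → ∀ w → G ∈ᶠ ctx w → w ⊩ᶜ G
  ⊬⇒⊮ : ∀ {G} → G ≼ A₀ → ∀ w → ¬ ctx w ⊢ₛ G → ¬ w ⊩ᶜ G

  ∈⇒⊩ {var _} _ w G∈ = G∈
  ∈⇒⊩ {⊥'} _ w G∈ = G∈
  ∈⇒⊩ {a ∧ b} G≼ w G∈ with a∈ , b∈ ← saturated⇒closed (saturated w) G∈ =
    ∈⇒⊩ (∧≼⇒ˡ G≼) w a∈ , ∈⇒⊩ (∧≼⇒ʳ G≼) w b∈
  ∈⇒⊩ {a ∨ b} G≼ w G∈ =
    Sum.map (∈⇒⊩ (∨≼⇒ˡ G≼) w) (∈⇒⊩ (∨≼⇒ʳ G≼) w) (saturated⇒closed (saturated w) G∈)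
  ∈⇒⊩ {a ⇒ b} G≼ w G∈ v w≤v v⊩a with saturated⇒closed (saturated v) (w≤v G∈)
  ... | inj₁ b∈ = ∈⇒⊩ (⇒≼⇒ʳ G≼) v b∈
  ... | inj₂ ⊬a = contradiction v⊩a (⊬⇒⊮ (⇒≼⇒ˡ G≼) v ⊬a)
  ∈⇒⊩ {□ b} G≼ w G∈ v w≤v u (unboxed , _) = ∈⇒⊩ (□≼⇒ G≼) u (unboxed (w≤v G∈))
  ∈⇒⊩ {◇ b} G≼ w G∈ v w≤v with u , vRu , b∈ ← ◇-successor v (w≤v G∈) =
    u , vRu , ∈⇒⊩ (◇≼⇒ G≼) u b∈

  ⊬⇒⊮ {var _} G≼ w ⊬G = ⊬-init G≼ ⊬G
  ⊬⇒⊮ {⊥'} G≼ w ⊬G = ⊬-init G≼ ⊬G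
  ⊬⇒⊮ {a ∧ b} G≼ w ⊬G (⊩a , ⊩b) with ⊢ₛ-dec (ctx w) a
  ... | no ⊬a = ⊬⇒⊮ (∧≼⇒ˡ G≼) w ⊬a ⊩a
  ... | yes ⊢a = ⊬⇒⊮ (∧≼⇒ʳ G≼) w (⊬-right G≼ ⊬G ∘ ∧R ⊢a) ⊩b
  ⊬⇒⊮ {a ∨ b} G≼ w ⊬G (inj₁ ⊩a) = ⊬⇒⊮ (∨≼⇒ˡ G≼) w (⊬-right G≼ ⊬G ∘ ∨R₁) ⊩a
  ⊬⇒⊮ {a ∨ b} G≼ w ⊬G (inj₂ ⊩b) = ⊬⇒⊮ (∨≼⇒ʳ G≼) w (⊬-right G≼ ⊬G ∘ ∨R₂) ⊩b
  ⊬⇒⊮ {a ⇒ b} G≼ w ⊬G ⊩G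
    with Y , ⊆Y , satY , ⊬b ← saturate (⇒≼⇒ʳ G≼) (⊬-right G≼ ⊬G ∘ ⇒R) =
    ⊬⇒⊮ (⇒≼⇒ʳ G≼) v ⊬b (⊩G v (⊆Y ∘ ◂-there) (∈⇒⊩ (⇒≼⇒ˡ G≼) v (⊆Y (◂-here (⇒≼⇒ˡ G≼)))))
    where
      v = plain Y satY
  ⊬⇒⊮ {□ b} G≼ w ⊬G ⊩G
    with Z , ⊆Z , satZ , ⊬b ← saturate (□≼⇒ G≼) (⊬-right G≼ ⊬G ∘ □R) =
    ⊬⇒⊮ (□≼⇒ G≼) u ⊬b (⊩G (plain (ctx w) (saturated w)) id u ((⊆Z ∘ unbox⁺) , nothing))
    where
      u = plain Z satZ
  ⊬⇒⊮ {◇ b} G≼ w ⊬G ⊩G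
    with u , (_ , just ⊬b) , ⊩b ← ⊩G (world (ctx w) (saturated w) (just b) (just (G≼ , ⊬G))) id =
    ⊬⇒⊮ (◇≼⇒ G≼) u ⊬b ⊩b

  valid⇒MK⊢ : (∀ w → w ⊩ᶜ A₀) → MK⊢ A₀
  valid⇒MK⊢ valid with ⊢ₛ-dec Subset.⊥ A₀
  ... | yes ⊢A₀ = ⊢⇒MK⊢ ∉ᶠ-⊥ (⊢ₛ-sound ⊢A₀)
  ... | no ⊬A₀ with Y , _ , satY , ⊬A₀′ ← saturate ≼-refl ⊬A₀ =
    ⊥-elim (⊬⇒⊮ ≼-refl (plain Y satY) ⊬A₀′ (valid (plain Y satY)))

mainTheorem3 : (A : Form) → (∀ {ℓ : Level} (M : Model ℓ) → ValidIn M A) → MK⊢ A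
mainTheorem3 A valid = valid⇒MK⊢ (valid canonical)
  where open Canonical A
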